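{- Let $\mathcal{S}=(E,\mathcal{I})$ be an $r$-covering system with set of bases $\mathcal{B}$ and activity $\texttt{a}$, and let $X\in\mathcal{I}$. Set $\mathcal{I}_X=\{I\in\mathcal{I}: X\subseteq I\}$, $\mathcal{B}_X=\{B\in\mathcal{B}: X\subseteq B\}$, and $\texttt{a}_X(B)=\texttt{a}(B)\setminus X$ for $B\in\mathcal{B}_X$. Then $\mathcal{S}_X=(E,\mathcal{I}_X)$ is an $r$-covering system and $\texttt{a}_X$ is an activity of $\mathcal{S}_X$.
   Context: For finite sets $X\subseteq Y$, write $[X,Y]=\{Z : X\subseteq Z\subseteq Y\}$. An $r$-covering system is a pair $\mathcal{S}=(E,\mathcal{I})$ with $E$ a finite set and $\mathcal{I}$ a collection of subsets of $E$, each of cardinality at most $r$, such that for every $I\in\mathcal{I}$ there is an $r$-element set $B\in\mathcal{I}$ with $[I,B]\subseteq\mathcal{I}$. The $r$-element sets in $\mathcal{I}$ are called bases. An activity of a covering system with set of bases $\mathcal{B}$ and independent sets $\mathcal{I}$ is a function $\texttt{a}:\mathcal{B}\to 2^E$ with $\texttt{a}(B)\subseteq B$, $[B\setminus\texttt{a}(B),B]\subseteq\mathcal{I}$ for all $B\in\mathcal{B}$, and such that every $I\in\mathcal{I}$ lies in $[B\setminus\texttt{a}(B),B]$ for exactly one $B\in\mathcal{B}$. -}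

module Defs where

open import Level using (Level; suc; _⊔_)
open import Data.Nat using (ℕ; _≤_)
open import Data.Fin.Subset using (Subset; _⊆_; _─_; ∣_∣)
open import Data.Product using (Σ; _×_; ∃-syntax)
open import Relation.Binary.PropositionalEquality using (_≡_)

-- Ground set E is Fin n; subsets of E are Subset n.
-- A collection 𝓘 of subsets of E is a predicate on Subset n.
Collection : ℕ → Set₁
Collection n = Subset n → Set

InInterval : {n : ℕ} → Subset n → Subset n → Subset n → Set
InInterval X Y Z = X ⊆ Z × Z ⊆ Y

IntervalIn : {n : ℕ} → Collection n → Subset n → Subset n → Set
IntervalIn {n} 𝓘 X Y = (Z : Subset n) → InInterval X Y Z → 𝓘 Z

IsBasis : {n : ℕ} → ℕ → Collection n → Subset n → Set
IsBasis r 𝓘 B = 𝓘 B × ∣ B ∣ ≡ r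

record IsCoveringSystem {n : ℕ} (r : ℕ) (𝓘 : Collection n) : Set where
  field
    card-≤ : (I : Subset n) → 𝓘 I → ∣ I ∣ ≤ r
    covered : (I : Subset n) → 𝓘 I →
      ∃[ B ] (IsBasis r 𝓘 B × I ⊆ B × IntervalIn 𝓘 I B)

-- a is an activity of the covering system (E , 𝓘) whose bases are the
-- r-element members of 𝓘.  The function a is only constrained on bases.
record IsActivity {n : ℕ} (r : ℕ) (𝓘 : Collection n) (a : Subset n → Subset n) : Set where
  field
    sub : (B : Subset n) → IsBasis r 𝓘 B → a B ⊆ B
    interval : (B : Subset n) → IsBasis r 𝓘 B → IntervalIn 𝓘 (B ─ a B) B
    exists : (I : Subset n) → 𝓘 I →
      ∃[ B ] (IsBasis r 𝓘 B × InInterval (B ─ a B) B I)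
    unique : (I : Subset n) → 𝓘 I → (B B' : Subset n) →
      IsBasis r 𝓘 B → InInterval (B ─ a B) B I →
      IsBasis r 𝓘 B' → InInterval (B' ─ a B') B' I → B ≡ B'

Restrict : {n : ℕ} → Collection n → Subset n → Collection n
Restrict 𝓘 X I = 𝓘 I × X ⊆ I

restrictActivity : {n : ℕ} → (Subset n → Subset n) → Subset n → Subset n → Subset n
restrictActivity a X B = a B ─ X

-- Restricting to the sets above X keeps every basis B ⊇ X, and for such B
-- the interval [B ∖ (a(B) ∖ X), B] consists exactly of the members of
-- [B ∖ a(B), B] that contain X.  Hence the activity intervals of S_X are
-- those of S cut down to 𝓘_X, and existence and uniqueness transfer.
module Submission where

open import Defs
open import Data.Nat using (ℕ)
open import Data.Fin using (Fin)
open import Data.Fin.Subset using (Subset; _∈_; _∉_; _⊆_; _─_; inside; outside)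
open import Data.Fin.Subset.Properties using (_∈?_; p─q⊆p; x∈p∧x∉q⇒x∈p─q)
open import Data.Vec using (_∷_; here; there)
open import Data.Product using (_×_; _,_; proj₁; proj₂; ∃-syntax)
open import Relation.Nullary using (yes; no)
open import Relation.Binary.PropositionalEquality using (_≡_)

private
  variable
    n r : ℕ
    x : Fin n
    p q s B A X Z : Subset n
    𝓘 : Collection n

x∈p─q⇒x∉q : x ∈ p ─ q → x ∉ q
x∈p─q⇒x∉q {p = inside ∷ _} {q = outside ∷ _} here ()
x∈p─q⇒x∉q {p = _ ∷ _} {q = _ ∷ _} (there x∈p─q) (there x∈q) = x∈p─q⇒x∉q x∈p─q x∈q

p─q⊆p─[q─s] : p ─ q ⊆ p ─ (q ─ s)
p─q⊆p─[q─s] {p = p} {q = q} x∈p─q =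
  x∈p∧x∉q⇒x∈p─q (p─q⊆p p q x∈p─q) (λ x∈q─s → x∈p─q⇒x∉q x∈p─q (p─q⊆p q _ x∈q─s))

s⊆p⇒s⊆p─[q─s] : s ⊆ p → s ⊆ p ─ (q ─ s)
s⊆p⇒s⊆p─[q─s] s⊆p x∈s = x∈p∧x∉q⇒x∈p─q (s⊆p x∈s) (λ x∈q─s → x∈p─q⇒x∉q x∈q─s x∈s)

x∈p─[q─s]∧x∉s⇒x∈p─q : x ∈ p ─ (q ─ s) → x ∉ s → x ∈ p ─ q
x∈p─[q─s]∧x∉s⇒x∈p─q {p = p} x∈ x∉s =
  x∈p∧x∉q⇒x∈p─q (p─q⊆p p _ x∈) (λ x∈q → x∈p─q⇒x∉q x∈ (x∈p∧x∉q⇒x∈p─q x∈q x∉s))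

restricted-interval⁻ : X ⊆ B → InInterval (B ─ (A ─ X)) B Z →
                       InInterval (B ─ A) B Z × X ⊆ Z
restricted-interval⁻ X⊆B (lower , upper) =
  ((λ x∈ → lower (p─q⊆p─[q─s] x∈)) , upper) , λ x∈X → lower (s⊆p⇒s⊆p─[q─s] X⊆B x∈X)

restricted-interval⁺ : InInterval (B ─ A) B Z → X ⊆ Z → InInterval (B ─ (A ─ X)) B Z
restricted-interval⁺ {B = B} {A = A} {Z = Z} {X = X} (lower , upper) X⊆Z = lower′ , upper
  where
  lower′ : B ─ (A ─ X) ⊆ Z
  lower′ {x} x∈ with x ∈? X
  ... | yes x∈X = X⊆Z x∈X
  ... | no  x∉X = lower (x∈p─[q─s]∧x∉s⇒x∈p─q x∈ x∉X)

restrict-isBasis : IsBasis r 𝓘 B → X ⊆ B → IsBasis r (Restrict 𝓘 X) B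
restrict-isBasis (B∈𝓘 , ∣B∣≡r) X⊆B = (B∈𝓘 , X⊆B) , ∣B∣≡r

restrict-isCoveringSystem : IsCoveringSystem r 𝓘 → IsCoveringSystem r (Restrict 𝓘 X)
restrict-isCoveringSystem {r = r} {𝓘 = 𝓘} {X = X} cs = record
  { card-≤  = λ I I∈ → card-≤ I (proj₁ I∈)
  ; covered = covered′
  }
  where
  open IsCoveringSystem cs
  covered′ : ∀ I → Restrict 𝓘 X I →
             ∃[ B ] (IsBasis r (Restrict 𝓘 X) B × I ⊆ B × IntervalIn (Restrict 𝓘 X) I B)
  covered′ I (I∈𝓘 , X⊆I) with covered I I∈𝓘
  ... | B , basis , I⊆B , [I,B]⊆𝓘 =
    B , restrict-isBasis {𝓘 = 𝓘} basis (λ x∈X → I⊆B (X⊆I x∈X)) , I⊆B ,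
    λ Z (I⊆Z , Z⊆B) → [I,B]⊆𝓘 Z (I⊆Z , Z⊆B) , λ x∈X → I⊆Z (X⊆I x∈X)

restrict-isActivity : {a : Subset n → Subset n} →
                      IsActivity r 𝓘 a → IsActivity r (Restrict 𝓘 X) (restrictActivity a X)
restrict-isActivity {n = n} {r = r} {𝓘 = 𝓘} {X = X} {a = a} act = record
  { sub      = λ B ((B∈𝓘 , _) , ∣B∣≡r) x∈ → sub B (B∈𝓘 , ∣B∣≡r) (p─q⊆p (a B) X x∈)
  ; interval = interval′
  ; exists   = exists′
  ; unique   = unique′
  }
  where
  open IsActivity act

  interval′ : (B : Subset n) → IsBasis r (Restrict 𝓘 X) B →
              IntervalIn (Restrict 𝓘 X) (B ─ (a B ─ X)) B
  interval′ B ((B∈𝓘 , X⊆B) , ∣B∣≡r) Z Z∈ =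
    let (Z∈[B─aB,B] , X⊆Z) = restricted-interval⁻ X⊆B Z∈
    in interval B (B∈𝓘 , ∣B∣≡r) Z Z∈[B─aB,B] , X⊆Z

  exists′ : (I : Subset n) → Restrict 𝓘 X I →
            ∃[ B ] (IsBasis r (Restrict 𝓘 X) B × InInterval (B ─ (a B ─ X)) B I)
  exists′ I (I∈𝓘 , X⊆I) with exists I I∈𝓘
  ... | B , basis , I∈[B─aB,B] =
    B , restrict-isBasis {𝓘 = 𝓘} basis (λ x∈X → proj₂ I∈[B─aB,B] (X⊆I x∈X)) ,
    restricted-interval⁺ I∈[B─aB,B] X⊆I

  unique′ : (I : Subset n) → Restrict 𝓘 X I → (B B′ : Subset n) →
            IsBasis r (Restrict 𝓘 X) B → InInterval (B ─ (a B ─ X)) B I →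
            IsBasis r (Restrict 𝓘 X) B′ → InInterval (B′ ─ (a B′ ─ X)) B′ I → B ≡ B′
  unique′ I (I∈𝓘 , _) B B′ ((B∈𝓘 , X⊆B) , ∣B∣≡r) I∈ ((B′∈𝓘 , X⊆B′) , ∣B′∣≡r) I∈′ =
    unique I I∈𝓘 B B′ (B∈𝓘 , ∣B∣≡r) (proj₁ (restricted-interval⁻ X⊆B I∈))
                      (B′∈𝓘 , ∣B′∣≡r) (proj₁ (restricted-interval⁻ X⊆B′ I∈′))

proposition3p8 : (n r : ℕ) (𝓘 : Collection n) (a : Subset n → Subset n) →
    IsCoveringSystem r 𝓘 → IsActivity r 𝓘 a →
    (X : Subset n) → 𝓘 X →
    IsCoveringSystem r (Restrict 𝓘 X) × IsActivity r (Restrict 𝓘 X) (restrictActivity a X)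
proposition3p8 n r 𝓘 a cs act X _ = restrict-isCoveringSystem cs , restrict-isActivity act
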